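{- Let $b\geq 2$ be an integer. For every positive integer $t$, there exist positive integers $n$ and $d$ such that $n+jd$ is $b$-anti-Niven for every $0\leq j\leq t-1$.
   Context: For a positive integer $n$ with base-$b$ expansion $n=\sum_{j=0}^m a_jb^j$ ($0\leq a_j\leq b-1$), $s_b(n)=\sum_{j=0}^m a_j$. A positive integer $n$ is $b$-anti-Niven if $\gcd(n,s_b(n))=1$. -}

module Defs where

open import Data.Nat using (ℕ; zero; suc; _+_; _*_; _≤_; _<_; NonZero)
open import Data.Nat.DivMod using (_/_; _%_)
open import Data.Nat.GCD using (gcd)
open import Relation.Binary.PropositionalEquality using (_≡_)

-- Sum of base-b digits, computed with fuel: each step divides by b ≥ 2,
-- so fuel n (number of steps ≤ n) suffices for the input n.
digitSumFuel : (b : ℕ) → .{{_ : NonZero b}} → ℕ → ℕ → ℕ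
digitSumFuel b zero    m = 0
digitSumFuel b (suc f) zero = 0
digitSumFuel b (suc f) m@(suc _) = m % b + digitSumFuel b f (m / b)

s : (b : ℕ) → .{{_ : NonZero b}} → ℕ → ℕ
s b n = digitSumFuel b n n

AntiNiven : (b : ℕ) → .{{_ : NonZero b}} → ℕ → Set
AntiNiven b n = gcd n (s b n) ≡ 1

{-# OPTIONS --safe #-}
module Submission where

open import Defs
open import Data.Nat using (ℕ; zero; suc; _+_; _*_; _∸_; _^_; _≤_; _<_; NonZero; z≤n; s≤s)
open import Data.Nat.Properties
open import Data.Nat.DivMod
open import Data.Nat.Divisibility
open import Data.Nat.GCD using (gcd)
open import Data.Nat.Coprimality using (Coprime; coprime-divisor; coprime⇒gcd≡1)
open import Data.Nat.Tactic.RingSolver using (solve-∀)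
open import Data.Product using (Σ; _×_; _,_)
open import Relation.Binary.PropositionalEquality

-- Take M = (b^t − 1)/(b − 1), the base-b repunit of length t, and
-- d = b(b^M − 1), n = 1 + d.  Then n + jd = 1 + b·(j+1)(b^M − 1), and for
-- j < b^M the number (j+1)(b^M − 1) = j·b^M + (b^M − 1 − j) has digit sum
-- s(j) + s(b^M − 1 − j) = (b − 1)M, the two halves being complementary digit
-- by digit.  Hence s_b(n + jd) = 1 + (b − 1)M = b^t, which is coprime to
-- n + jd ≡ 1 (mod b).

repunit : ℕ → ℕ → ℕ
repunit b zero    = 0
repunit b (suc k) = suc (b * repunit b k)

repunit-spec : ∀ b .{{_ : NonZero b}} k → suc ((b ∸ 1) * repunit b k) ≡ b ^ k
repunit-spec b       zero    = cong suc (*-zeroʳ (b ∸ 1))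
repunit-spec b@(suc c) (suc k) = begin
  suc (c * suc (b * r))   ≡⟨ geometric c r ⟩
  b * suc (c * r)         ≡⟨ cong (b *_) (repunit-spec b k) ⟩
  b * b ^ k               ∎
  where
  open ≡-Reasoning
  r = repunit b k
  geometric : ∀ c r → suc (c * suc (suc c * r)) ≡ suc c * suc (c * r)
  geometric = solve-∀

n≤repunit : ∀ b .{{_ : NonZero b}} n → n ≤ repunit b n
n≤repunit b zero    = z≤n
n≤repunit b (suc n) = s≤s (≤-trans (n≤repunit b n) (m≤n*m _ b))

n<b^n : ∀ {b} → 1 < b → ∀ n → n < b ^ n
n<b^n {b@(suc (suc c))} (s≤s (s≤s z≤n)) n = begin-strict
  n                            ≤⟨ n≤repunit b n ⟩
  repunit b n                  ≤⟨ m≤n*m _ (suc c) ⟩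
  (b ∸ 1) * repunit b n        <⟨ ≤-refl ⟩
  suc ((b ∸ 1) * repunit b n)  ≡⟨ repunit-spec b n ⟩
  b ^ n                        ∎
  where open ≤-Reasoning

coprime-^ : ∀ {m n} → Coprime m n → ∀ k → Coprime m (n ^ k)
coprime-^ m⊥n zero    (_ , d∣1)       = ∣1⇒≡1 d∣1
coprime-^ m⊥n (suc k) {d} (d∣m , d∣nnᵏ) =
  coprime-^ m⊥n k (d∣m , coprime-divisor d⊥n d∣nnᵏ)
  where
  d⊥n : Coprime d _
  d⊥n (e∣d , e∣n) = m⊥n (∣-trans e∣d d∣m , e∣n)

1+*-coprime : ∀ x b → Coprime (1 + x * b) b
1+*-coprime x b {e} (e∣1+xb , e∣b) =
  ∣1⇒≡1 (∣m+n∣m⇒∣n (subst (e ∣_) (+-comm 1 (x * b)) e∣1+xb) (∣n⇒∣m*n x e∣b))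

module DigitSum (b : ℕ) .{{_ : NonZero b}} (1<b : 1 < b) where

  digitSumFuel-zero : ∀ f → digitSumFuel b f 0 ≡ 0
  digitSumFuel-zero zero    = refl
  digitSumFuel-zero (suc f) = refl

  m/b<m : ∀ m .{{_ : NonZero m}} → m / b < m
  m/b<m m = m/n<m m b 1<b

  digitSumFuel-fuel : ∀ {f g} m → m ≤ f → m ≤ g → digitSumFuel b f m ≡ digitSumFuel b g m
  digitSumFuel-fuel {f} {g} zero _ _ = trans (digitSumFuel-zero f) (sym (digitSumFuel-zero g))
  digitSumFuel-fuel {suc f} {suc g} m@(suc k) (s≤s k≤f) (s≤s k≤g) =
    cong (m % b +_) (digitSumFuel-fuel (m / b) (≤-trans q≤k k≤f) (≤-trans q≤k k≤g))
    where
    q≤k : m / b ≤ k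
    q≤k = ≤-pred (m/b<m m)

  s-unfold : ∀ m → s b m ≡ m % b + s b (m / b)
  s-unfold zero = sym (cong₂ _+_ (m<n⇒m%n≡m (<-trans (s≤s z≤n) 1<b)) (cong (s b) (0/n≡0 b)))
  s-unfold m@(suc k) =
    cong (m % b +_) (digitSumFuel-fuel (m / b) (≤-pred (m/b<m m)) ≤-refl)

  s-digit+ : ∀ {a} q → a < b → s b (a + q * b) ≡ a + s b q
  s-digit+ {a} q a<b = trans (s-unfold (a + q * b)) (cong₂ _+_ low (cong (s b) high))
    where
    low : (a + q * b) % b ≡ a
    low = trans ([m+kn]%n≡m%n a q b) (m<n⇒m%n≡m a<b)
    high : (a + q * b) / b ≡ q
    high = trans (+-distrib-/-∣ʳ a (divides-refl q))
                 (cong₂ _+_ (m<n⇒m/n≡0 a<b) (m*n/n≡m q b))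

  s-split : ∀ y → s b y ≡ y % b + s b (y / b)
  s-split y = trans (cong (s b) (m≡m%n+[m/n]*n y b)) (s-digit+ (y / b) (m%n<n y b))

  /b<b^ : ∀ {y} k → y < b ^ suc k → y / b < b ^ k
  /b<b^ {y} k y<bb^k = m<n*o⇒m/o<n (subst (y <_) (*-comm b (b ^ k)) y<bb^k)

  s-concat : ∀ k {y} x → y < b ^ k → s b (y + b ^ k * x) ≡ s b y + s b x
  s-concat zero {zero} x _ = cong (s b) (+-identityʳ x)
  s-concat zero {suc _} x (s≤s ())
  s-concat (suc k) {y} x y<b^k = begin
    s b (y + b ^ suc k * x)            ≡⟨ cong (s b) shift ⟩
    s b (y₀ + (y₁ + b ^ k * x) * b)    ≡⟨ s-digit+ (y₁ + b ^ k * x) (m%n<n y b) ⟩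
    y₀ + s b (y₁ + b ^ k * x)          ≡⟨ cong (y₀ +_) (s-concat k x (/b<b^ k y<b^k)) ⟩
    y₀ + (s b y₁ + s b x)              ≡⟨ +-assoc y₀ _ _ ⟨
    y₀ + s b y₁ + s b x                ≡⟨ cong (_+ s b x) (s-split y) ⟨
    s b y + s b x                      ∎
    where
    open ≡-Reasoning
    y₀ = y % b
    y₁ = y / b
    regroup : ∀ y₀ y₁ P x b → y₀ + y₁ * b + b * P * x ≡ y₀ + (y₁ + P * x) * b
    regroup = solve-∀
    shift : y + b ^ suc k * x ≡ y₀ + (y₁ + b ^ k * x) * b
    shift = trans (cong (_+ b ^ suc k * x) (m≡m%n+[m/n]*n y b)) (regroup y₀ y₁ (b ^ k) x b)

  s-complement : ∀ k {y} → y < b ^ k → s b y + s b (b ^ k ∸ suc y) ≡ (b ∸ 1) * k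
  s-complement zero {zero} _ = sym (*-zeroʳ (b ∸ 1))
  s-complement zero {suc _} (s≤s ())
  s-complement (suc k) {y} y<b^k = begin
    s b y + s b (b ^ suc k ∸ suc y)        ≡⟨ cong₂ _+_ (s-split y) (cong (s b) complement-digits) ⟩
    (y₀ + s b y₁) + s b (z₀ + z₁ * b)      ≡⟨ cong ((y₀ + s b y₁) +_) (s-digit+ z₁ z₀<b) ⟩
    (y₀ + s b y₁) + (z₀ + s b z₁)          ≡⟨ interchange y₀ (s b y₁) z₀ (s b z₁) ⟩
    (y₀ + z₀) + (s b y₁ + s b z₁)          ≡⟨ cong₂ _+_ (cong (_∸ 1) y₀+z₀) (s-complement k y₁<b^k) ⟩
    (b ∸ 1) + (b ∸ 1) * k                  ≡⟨ *-suc (b ∸ 1) k ⟨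
    (b ∸ 1) * suc k                        ∎
    where
    open ≡-Reasoning
    y₀ = y % b
    y₁ = y / b
    y₁<b^k = /b<b^ k y<b^k
    z₀ = b ∸ suc y₀
    z₁ = b ^ k ∸ suc y₁
    y₀+z₀ : suc y₀ + z₀ ≡ b
    y₀+z₀ = m+[n∸m]≡n (m%n<n y b)
    y₁+z₁ : suc y₁ + z₁ ≡ b ^ k
    y₁+z₁ = m+[n∸m]≡n y₁<b^k
    z₀<b : z₀ < b
    z₀<b = subst (suc z₀ ≤_) y₀+z₀ (s≤s (m≤n+m z₀ y₀))
    interchange : ∀ a b c d → (a + b) + (c + d) ≡ (a + c) + (b + d)
    interchange = solve-∀
    expand : ∀ y₀ z₀ y₁ z₁ → (suc y₀ + z₀) * (suc y₁ + z₁)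
                           ≡ suc (y₀ + y₁ * (suc y₀ + z₀)) + (z₀ + z₁ * (suc y₀ + z₀))
    expand = solve-∀
    b′ = suc y₀ + z₀
    b^sk≡ : b ^ suc k ≡ suc y + (z₀ + z₁ * b)
    b^sk≡ = begin
      b * b ^ k                                  ≡⟨ cong₂ _*_ (sym y₀+z₀) (sym y₁+z₁) ⟩
      b′ * (suc y₁ + z₁)                         ≡⟨ expand y₀ z₀ y₁ z₁ ⟩
      suc (y₀ + y₁ * b′) + (z₀ + z₁ * b′)        ≡⟨ cong (λ c → suc (y₀ + y₁ * c) + (z₀ + z₁ * c)) y₀+z₀ ⟩
      suc (y₀ + y₁ * b) + (z₀ + z₁ * b)          ≡⟨ cong (λ c → suc c + (z₀ + z₁ * b)) (m≡m%n+[m/n]*n y b) ⟨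
      suc y + (z₀ + z₁ * b)                      ∎
    complement-digits : b ^ suc k ∸ suc y ≡ z₀ + z₁ * b
    complement-digits = trans (cong (_∸ suc y) b^sk≡) (m+n∸m≡n (suc y) _)

  s-*-pred-b^ : ∀ k {j} → j < b ^ k → s b (suc j * (b ^ k ∸ 1)) ≡ (b ∸ 1) * k
  s-*-pred-b^ k {j} j<b^k = begin
    s b (suc j * (b ^ k ∸ 1))         ≡⟨ cong (s b) (as-concat (sym j+c)) ⟩
    s b (c + b ^ k * j)               ≡⟨ s-concat k j c<b^k ⟩
    s b c + s b j                     ≡⟨ +-comm (s b c) (s b j) ⟩
    s b j + s b c                     ≡⟨ s-complement k j<b^k ⟩
    (b ∸ 1) * k                       ∎
    where
    open ≡-Reasoning
    c = b ^ k ∸ suc j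
    j+c : suc j + c ≡ b ^ k
    j+c = m+[n∸m]≡n j<b^k
    c<b^k : c < b ^ k
    c<b^k = subst (c <_) j+c (s≤s (m≤n+m c j))
    as-concat : ∀ {P} → P ≡ suc j + c → suc j * (P ∸ 1) ≡ c + P * j
    as-concat refl = identity j c
      where
      identity : ∀ j c → suc j * (j + c) ≡ c + (suc j + c) * j
      identity = solve-∀

  antiNiven-1+*b : ∀ x k → s b (1 + x * b) ≡ b ^ k → AntiNiven b (1 + x * b)
  antiNiven-1+*b x k s≡b^k =
    subst (λ z → gcd (1 + x * b) z ≡ 1) (sym s≡b^k)
          (coprime⇒gcd≡1 (coprime-^ (1+*-coprime x b) k))

theorem2p4 : (b : ℕ) → .{{_ : NonZero b}} → 2 ≤ b → (t : ℕ) → 1 ≤ t →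
    Σ ℕ λ n → Σ ℕ λ d → 1 ≤ n × 1 ≤ d ×
    ((j : ℕ) → j < t → AntiNiven b (n + j * d))
theorem2p4 b 1<b t 1≤t = 1 + d , d , s≤s z≤n , 1≤d , antiNiven
  where
  open DigitSum b 1<b
  M = repunit b t
  d = (b ^ M ∸ 1) * b
  t<b^M : t < b ^ M
  t<b^M = ≤-<-trans (n≤repunit b t) (n<b^n 1<b M)
  1≤d : 1 ≤ d
  1≤d = *-mono-≤ (∸-monoˡ-≤ 1 (≤-trans (s≤s 1≤t) t<b^M)) (<⇒≤ 1<b)
  progression : ∀ j E b → 1 + E * b + j * (E * b) ≡ 1 + (suc j * E) * b
  progression = solve-∀
  antiNiven : (j : ℕ) → j < t → AntiNiven b (1 + d + j * d)
  antiNiven j j<t = subst (AntiNiven b) (sym (progression j (b ^ M ∸ 1) b)) (antiNiven-1+*b x t (begin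
    s b (1 + x * b)       ≡⟨ s-digit+ x 1<b ⟩
    1 + s b x             ≡⟨ cong suc (s-*-pred-b^ M (<-trans j<t t<b^M)) ⟩
    1 + (b ∸ 1) * M       ≡⟨ repunit-spec b t ⟩
    b ^ t                 ∎))
    where
    open ≡-Reasoning
    x = suc j * (b ^ M ∸ 1)
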